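{- For every integer $n \geq 3$, the graph $C_n \star S_5$ is coprime.
   Context: A graph $G$ with $N$ vertices is \emph{coprime} (has a prime vertex labeling) if there is a bijection $f: V(G) \to \{1,2,\ldots,N\}$ such that $\gcd(f(u),f(v)) = 1$ for every edge $uv$ of $G$. For integers $n \geq 3$ and $m \geq 1$, the \emph{$m$-hairy $n$-cycle} $C_n \star S_m$ is the graph obtained from the cycle $C_n$ by attaching $m$ pendant vertices (vertices of degree one) to each cycle vertex; it has $(m+1)n$ vertices. -}

module Defs where

open import Data.Nat using (ℕ; zero; suc; _+_; _*_)
open import Data.Nat.Coprimality using (Coprime)
open import Data.Fin using (Fin; toℕ)
open import Data.Product using (_×_; _,_; proj₁; proj₂)
open import Data.Sum using (_⊎_)
open import Relation.Binary.PropositionalEquality using (_≡_)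
open import Function.Bundles using (_⤖_; Bijection)

-- A graph: a vertex type together with an edge relation
-- (edges are unordered; `Edge u v` records the edge uv in one orientation).
record Graph : Set₁ where
  field
    Vertex : Set
    Edge   : Vertex → Vertex → Set
open Graph public

-- We encode {1,…,N} as Fin N with label(k) = toℕ k + 1.
label : ∀ {N} → Fin N → ℕ
label k = suc (toℕ k)

IsCoprimeGraph : (G : Graph) (N : ℕ) → Set
IsCoprimeGraph G N =
  Data.Product.Σ (Vertex G ⤖ Fin N) λ f →
    ∀ u v → Edge G u v →
      Coprime (label (Bijection.to f u)) (label (Bijection.to f v))

-- Vertices: pairs (i , j) with i : Fin n, j : Fin (suc m).
--   (i , 0)      is the i-th cycle vertex,
--   (i , suc t)  is the t-th pendant vertex attached to cycle vertex i.
data HairyEdge (n m : ℕ) : Fin n × Fin (suc m) → Fin n × Fin (suc m) → Set where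
  cycleEdge   : ∀ (i i' : Fin n) → toℕ i' ≡ suc (toℕ i) →
                HairyEdge n m (i , Fin.zero) (i' , Fin.zero)
  wrapEdge    : ∀ (i i' : Fin n) → suc (toℕ i) ≡ n → toℕ i' ≡ 0 →
                HairyEdge n m (i , Fin.zero) (i' , Fin.zero)
  pendantEdge : ∀ (i : Fin n) (t : Fin m) →
                HairyEdge n m (i , Fin.zero) (i , Fin.suc t)

HairyCycle : (n m : ℕ) → Graph
HairyCycle n m = record { Vertex = Fin n × Fin (suc m) ; Edge = HairyEdge n m }

-- Give the pendant block of the i-th cycle vertex (counted from 0) the labels
-- 6i+1, …, 6i+6, the cycle vertex itself taking 1 when i = 0 and 6i+5 otherwise.
-- A label 6t+5 is prime to 2 and 3, hence to 12, and it differs from its pendants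
-- by 1, 2, 3 or 4 and from the next cycle label by 6, all divisors of 12; so any
-- common divisor of adjacent labels divides 12 and 6t+5, i.e. is 1.  The
-- remaining edges all touch the label 1.
module Submission where

open import Defs
open import Data.Nat using (ℕ; suc; _+_; _*_; _≥_)
open import Data.Nat.Properties using (+-assoc; +-suc; +-comm; *-comm; suc-injective)
open import Data.Nat.Divisibility using (_∣_; divides; ∣-trans; ∣m+n∣m⇒∣n)
open import Data.Nat.Coprimality using (Coprime; 1-coprimeTo; coprime-+; coprime-divisor; coprime?)
import Data.Nat.Coprimality as Coprime
open import Data.Fin using (Fin; suc; toℕ; combine)
open import Data.Fin.Patterns using (0F; 1F; 2F; 3F; 4F)
open import Data.Fin.Properties using (toℕ-cast; toℕ-combine; *↔×)
open import Data.Fin.Permutation using (Permutation′; _⟨$⟩ʳ_; _⟨$⟩ˡ_; inverseˡ; inverseʳ; transpose; cast-id)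
import Data.Fin.Permutation as Permutation
open import Data.Product using (_×_; _,_)
open import Function.Bundles using (_↔_; Inverse; mk↔ₛ′)
open import Function.Properties.Inverse using (↔-sym; ↔-trans; ↔⇒⤖)
open import Relation.Nullary.Decidable using (toWitness)
open import Relation.Binary.PropositionalEquality

coprime-+-distance : ∀ {a b k} → Coprime a k → a + k ≡ b → Coprime a b
coprime-+-distance c refl (d∣a , d∣a+k) = c (d∣a , ∣m+n∣m⇒∣n d∣a+k d∣a)

coprime-∸-distance : ∀ {a b k} → Coprime a k → b + k ≡ a → Coprime a b
coprime-∸-distance c refl (d∣b+k , d∣b) = c (d∣b+k , ∣m+n∣m⇒∣n d∣b+k d∣b)

coprime-∣ʳ : ∀ {a m k} → Coprime a m → k ∣ m → Coprime a k
coprime-∣ʳ c k∣m (d∣a , d∣k) = c (d∣a , ∣-trans d∣k k∣m)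

coprime-*ʳ : ∀ {a m n} → Coprime a m → Coprime a n → Coprime a (m * n)
coprime-*ʳ cm cn (d∣a , d∣mn) =
  cn (d∣a , coprime-divisor (λ (e∣d , e∣m) → cm (∣-trans e∣d d∣a , e∣m)) d∣mn)

coprime-*+ : ∀ {r n} q → Coprime r n → Coprime (q * n + r) n
coprime-*+         0       c = c
coprime-*+ {r} {n} (suc q) c =
  subst (λ a → Coprime a n) (sym (+-assoc n (q * n) r)) (coprime-+ (coprime-*+ q c))

hub : ℕ → ℕ
hub t = t * 6 + 5

hub-coprime-12 : ∀ t → Coprime (hub t) 12
hub-coprime-12 t = coprime-*ʳ {m = 2} {n = 6} (coprime-∣ʳ coprime-6 (divides 3 refl)) coprime-6
  where
  coprime-6 : Coprime (hub t) 6
  coprime-6 = coprime-*+ t (toWitness {a? = coprime? 5 6} _)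

hub-coprime-∣12 : ∀ t {k} → k ∣ 12 → Coprime (hub t) k
hub-coprime-∣12 t = coprime-∣ʳ (hub-coprime-12 t)

hub-coprime-next : ∀ t → Coprime (hub t) (hub (suc t))
hub-coprime-next t = coprime-+-distance (hub-coprime-∣12 t (divides 2 refl)) (+-comm (hub t) 6)

blockOrder : ∀ {n} → Fin n → Permutation′ 6
blockOrder 0F      = Permutation.id
blockOrder (suc _) = transpose 0F 4F

blockLabel : ∀ {n} → Fin n × Fin 6 → ℕ
blockLabel (i , j) = toℕ i * 6 + suc (toℕ (blockOrder i ⟨$⟩ʳ j))

hub-coprime-pendant : ∀ {n} (i : Fin n) (t : Fin 5) → Coprime (blockLabel (suc i , 0F)) (blockLabel (suc i , suc t))
hub-coprime-pendant i t = pendant t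
  where
  m : ℕ
  m = toℕ (suc i) * 6
  pendant : ∀ t → Coprime (m + 5) (blockLabel (suc i , suc t))
  pendant 0F = coprime-∸-distance (hub-coprime-∣12 (toℕ (suc i)) (divides 4 refl)) (+-assoc m 2 3)
  pendant 1F = coprime-∸-distance (hub-coprime-∣12 (toℕ (suc i)) (divides 6 refl)) (+-assoc m 3 2)
  pendant 2F = coprime-∸-distance (hub-coprime-∣12 (toℕ (suc i)) (divides 12 refl)) (+-assoc m 4 1)
  pendant 3F = coprime-∸-distance (hub-coprime-∣12 (toℕ (suc i)) (divides 3 refl)) (+-assoc m 1 4)
  pendant 4F = coprime-+-distance (hub-coprime-∣12 (toℕ (suc i)) (divides 12 refl)) (+-assoc m 5 1)

blockLabel-coprime : ∀ {n u v} → HairyEdge n 5 u v → Coprime (blockLabel u) (blockLabel v)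
blockLabel-coprime (cycleEdge 0F _ _)       = 1-coprimeTo _
blockLabel-coprime (cycleEdge (suc i) (suc i′) i′≡i+1)
  rewrite suc-injective i′≡i+1              = hub-coprime-next (toℕ (suc i))
blockLabel-coprime (wrapEdge _ 0F _ _)      = Coprime.sym (1-coprimeTo _)
blockLabel-coprime (pendantEdge 0F _)       = 1-coprimeTo _
blockLabel-coprime (pendantEdge (suc i) t)  = hub-coprime-pendant i t

fibrewise : ∀ {n k} → (Fin n → Permutation′ k) → (Fin n × Fin k) ↔ (Fin n × Fin k)
fibrewise π = mk↔ₛ′
  (λ (i , j) → i , π i ⟨$⟩ʳ j)
  (λ (i , j) → i , π i ⟨$⟩ˡ j)
  (λ (i , j) → cong (i ,_) (inverseʳ (π i)))
  (λ (i , j) → cong (i ,_) (inverseˡ (π i)))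

labelling : ∀ n → (Fin n × Fin 6) ↔ Fin (6 * n)
labelling n = ↔-trans (fibrewise blockOrder) (↔-trans (↔-sym *↔×) (cast-id (*-comm n 6)))

label-labelling : ∀ n u → label (Inverse.to (labelling n) u) ≡ blockLabel u
label-labelling n (i , j) = begin
  suc (toℕ (Inverse.to (labelling n) (i , j))) ≡⟨ cong suc (toℕ-cast _ (combine i o)) ⟩
  suc (toℕ (combine i o))                      ≡⟨ cong suc (toℕ-combine i o) ⟩
  suc (6 * toℕ i + toℕ o)                      ≡⟨ sym (+-suc (6 * toℕ i) (toℕ o)) ⟩
  6 * toℕ i + suc (toℕ o)                      ≡⟨ cong (_+ suc (toℕ o)) (*-comm 6 (toℕ i)) ⟩
  blockLabel (i , j)                           ∎
  where
  open ≡-Reasoning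
  o : Fin 6
  o = blockOrder i ⟨$⟩ʳ j

-- The construction works for every n.
mainTheorem2 : ∀ (n : ℕ) → n ≥ 3 → IsCoprimeGraph (HairyCycle n 5) ((5 + 1) * n)
mainTheorem2 n _ = ↔⇒⤖ (labelling n) , λ u v uv →
  subst₂ Coprime (sym (label-labelling n u)) (sym (label-labelling n v)) (blockLabel-coprime uv)
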